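{- Let $\lambda$ be a connectivity function on a finite set $E$, and let $E_1,\dots,E_m$ be a partition of $E$ into nonempty sets such that $\lambda(E_i)=0$ for all $i$. Let $\lambda_i$ be the restriction of $\lambda$ to subsets of $E_i$ (a connectivity function on $E_i$), let $k_i$ be the branch-depth of $\lambda_i$, and let $k=\max(k_1,\dots,k_m)$. Then the branch-depth of $\lambda$ is $k$ or $k+1$. Moreover, if the branch-depth of $\lambda$ is $k+1$, then there exist $i<j$ with $k_i=k_j=k$, and $\lambda$ has a $(k,k+1)$-decomposition.
   Context: A connectivity function on a finite set $E$ is $\lambda:2^E\to\mathbb Z$ with $\lambda(\emptyset)=0$, $\lambda(X)=\lambda(E\setminus X)$ for all $X$, and $\lambda(X)+\lambda(Y)\ge\lambda(X\cup Y)+\lambda(X\cap Y)$. A decomposition of $\lambda$ is a pair $(T,\sigma)$, $T$ a tree with at least one internal node and $\sigma$ a bijection from $E$ to the leaves of $T$. For an internal node $v$, the components of $T-v$ induce via $\sigma$ a partition $\mathcal P_v$ of $E$; the width of $v$ is $\max_{\mathcal P'\subseteq\mathcal P_v}\lambda(\bigcup_{X\in\mathcal P'}X)$; the width of $(T,\sigma)$ is the maximum over internal nodes; its radius is the minimum $r$ such that some node of $T$ is within distance $r$ of every node. A $(k,r)$-decomposition has width $\le k$ and radius $\le r$. The branch-depth of $\lambda$ is the minimum $k$ such that a $(k,k)$-decomposition exists, and $0$ if $|E|<2$. -}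

module Defs where

open import Data.Nat using (ℕ; zero; suc; _≤_; _<_; _⊔_)
open import Data.Integer using (ℤ; +_; _+_) renaming (_≤_ to _≤ℤ_)
open import Data.Fin using (Fin; zero; suc; inject₁; fromℕ; _≟_)
open import Data.Bool using (Bool; true; false; not; _∨_; _∧_)
open import Data.Product using (Σ; ∃; ∃-syntax; _×_; _,_)
open import Data.Sum using (_⊎_)
open import Data.Unit using (⊤)
open import Data.Empty using (⊥)
open import Relation.Nullary using (¬_; yes; no)
open import Relation.Binary.PropositionalEquality using (_≡_; _≢_)

Sub : Set → Set
Sub E = E → Bool

∅ : {E : Set} → Sub E
∅ _ = false

∁ : {E : Set} → Sub E → Sub E
∁ X e = not (X e)

_∪_ : {E : Set} → Sub E → Sub E → Sub E
(X ∪ Y) e = X e ∨ Y e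

_∩_ : {E : Set} → Sub E → Sub E → Sub E
(X ∩ Y) e = X e ∧ Y e

-- Connectivity functions.  `ext` records that the value depends only
-- on the subset (the extension of the predicate), which is automatic for
-- sets but must be stated since Agda has no function extensionality.

record IsConnectivity {E : Set} (conn : Sub E → ℤ) : Set where
  field
    empty  : conn ∅ ≡ + 0
    symm   : ∀ X → conn X ≡ conn (∁ X)
    submod : ∀ X Y → conn (X ∪ Y) + conn (X ∩ Y) ≤ℤ conn X + conn Y
    ext    : ∀ X Y → (∀ e → X e ≡ Y e) → conn X ≡ conn Y

data Walk {t : ℕ} (A : Fin t → Fin t → Set) (P : Fin t → Set)
          : Fin t → Fin t → ℕ → Set where
  here : ∀ {u} → P u → Walk A P u u 0
  step : ∀ {u w x l} → P u → A u w → Walk A P w x l → Walk A P u x (suc l)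

AllV : {t : ℕ} → Fin t → Set
AllV _ = ⊤

record Tree (t : ℕ) : Set₁ where
  field
    adj       : Fin t → Fin t → Set
    adj-sym   : ∀ u w → adj u w → adj w u
    adj-irr   : ∀ u → ¬ adj u u
    connected : ∀ u w → ∃[ l ] Walk adj AllV u w l
    acyclic   : ∀ (m : ℕ) (f : Fin (suc (suc (suc m))) → Fin t) →
                (∀ i j → f i ≡ f j → i ≡ j) →
                (∀ (i : Fin (suc (suc m))) → adj (f (inject₁ i)) (f (suc i))) →
                adj (f (fromℕ (suc (suc m)))) (f zero) → ⊥

  Leaf : Fin t → Set
  Leaf v = ∃[ u ] (adj v u × (∀ w → adj v w → w ≡ u))

  Internal : Fin t → Set
  Internal v = ¬ Leaf v

  SameCompWithout : Fin t → Fin t → Fin t → Set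
  SameCompWithout v u w = ∃[ l ] Walk adj (λ x → x ≢ v) u w l

record Decomposition (E : Set) : Set₁ where
  field
    size     : ℕ
    tree     : Tree size
  open Tree tree public
  field
    σ         : E → Fin size
    σ-inj     : ∀ e f → σ e ≡ σ f → e ≡ f
    σ-leaf    : ∀ e → Leaf (σ e)
    σ-onto    : ∀ v → Leaf v → ∃[ e ] σ e ≡ v
    hasInternal : ∃[ v ] Internal v

  SamePart : Fin size → E → E → Set
  SamePart v e f = SameCompWithout v (σ e) (σ f)

  UnionOfParts : Fin size → Sub E → Set
  UnionOfParts v X = ∀ e f → SamePart v e f → X e ≡ true → X f ≡ true

WidthAtMost : {E : Set} → (Sub E → ℤ) → Decomposition E → ℕ → Set
WidthAtMost conn D k =
  ∀ v → Internal v → ∀ X → UnionOfParts v X → conn X ≤ℤ + k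
  where open Decomposition D

RadiusAtMost : {E : Set} → Decomposition E → ℕ → Set
RadiusAtMost D r = ∃[ c ] (∀ u → ∃[ l ] (l ≤ r × Walk adj AllV c u l))
  where open Decomposition D

HasDecomp : {E : Set} → (Sub E → ℤ) → ℕ → ℕ → Set₁
HasDecomp {E} conn k r =
  Σ (Decomposition E) λ D → WidthAtMost conn D k × RadiusAtMost D r

BranchDepth : {E : Set} → (Sub E → ℤ) → ℕ → Set₁
BranchDepth {E} conn d =
  (((a b : E) → a ≡ b) × d ≡ 0)
  ⊎ ((Σ E λ a → Σ E λ b → a ≢ b)
     × HasDecomp conn d d
     × (∀ j → j < d → ¬ HasDecomp conn j j))

Block : {n m : ℕ} → (Fin n → Fin m) → Fin m → Set
Block {n} part i = Σ (Fin n) λ e → part e ≡ i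

blockSet : {n m : ℕ} → (Fin n → Fin m) → Fin m → Sub (Fin n)
blockSet part i e with part e ≟ i
... | yes _ = true
... | no  _ = false

extendSub : {n m : ℕ} (part : Fin n → Fin m) (i : Fin m) →
            Sub (Block part i) → Sub (Fin n)
extendSub part i Y e with part e ≟ i
... | yes p = Y (e , p)
... | no  _ = false

restrict : {n m : ℕ} → (Sub (Fin n) → ℤ) → (part : Fin n → Fin m) →
           (i : Fin m) → Sub (Block part i) → ℤ
restrict conn part i Y = conn (extendSub part i Y)

-- maximum of finitely many naturals (0 for the empty family)
maxF : {m : ℕ} → (Fin m → ℕ) → ℕ
maxF {zero}  f = 0
maxF {suc m} f = f zero ⊔ maxF (λ i → f (suc i))

-- Let k be the largest k_i. Restricting a (d,d)-decomposition of λ to a block E_i and pruning the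
-- leaves outside E_i gives a (d,d)-decomposition of λ_i, because λ(E_i) = 0 forces
-- λ(X ∩ E_i) ≤ λ(X); hence k ≤ d. Conversely, take (k_i,k_i)-decompositions of the blocks with
-- internal centres and join the centres by spokes to a hub. At a node of block j a union of parts
-- differs from a union of parts of block j's tree only by whole blocks, which have connectivity 0,
-- so the width stays at most k. If the maximum is attained by a single block, its centre serves as
-- the hub and the radius stays k; otherwise a new hub gives radius k + 1.
module Submission where

open import Defs
open import Data.Nat using (ℕ; suc)
open import Data.Integer using (ℤ; +_)
open import Data.Fin using (Fin; _<_)
open import Data.Product using (∃; ∃-syntax; _×_)
open import Data.Sum using (_⊎_)
open import Relation.Binary.PropositionalEquality using (_≡_)

open import Data.Nat using (zero; _+_; z≤n; s≤s) renaming (_≤_ to _≤ₙ_; _<_ to _<ₙ_)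
import Data.Nat.Properties as ℕP
open import Data.Integer using (-[1+_]; +≤+) renaming (_+_ to _+ᶻ_; _≤_ to _≤ᶻ_)
import Data.Integer.Properties as ℤP
open import Data.Fin using (zero; suc; inject₁; fromℕ; toℕ; punchIn; punchOut; _↑ˡ_; _↑ʳ_; splitAt)
  renaming (_≟_ to _≟ᶠ_; _≤_ to _≤ᶠ_)
import Data.Fin.Properties as FinP
import Data.Bool.Properties as BoolP
import Data.Product.Properties as ProdP
open import Data.Product using (Σ; _,_; proj₁; proj₂)
open import Data.Sum using (inj₁; inj₂; [_,_]′)
import Data.Sum
open import Data.Empty using (⊥; ⊥-elim)
open import Data.Unit using (tt)
open import Data.Bool using (Bool; true; false; not; _∧_)
open import Function using (_∘_; _∋_; case_of_)
open import Relation.Binary using (tri<; tri≈; tri>)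
open import Relation.Nullary using (¬_; Dec; yes; no; does; _×-dec_)
open import Relation.Nullary.Decidable
  using (dec-true; dec-false; decidable-stable; ¬¬-excluded-middle; recompute)
import Relation.Nullary.Decidable as Dec
open import Relation.Binary.PropositionalEquality
  using (refl; sym; trans; cong; cong₂; subst; subst₂; _≢_; _≗_; module ≡-Reasoning)
import Axiom.UniquenessOfIdentityProofs as UIP

¬¬-decidable : ∀ t (P : Fin t → Set) → ¬ ¬ (∀ v → Dec (P v))
¬¬-decidable zero P k = k (λ ())
¬¬-decidable (suc t) P k =
  ¬¬-excluded-middle λ p₀? → ¬¬-decidable t (P ∘ suc) λ ps? →
  k λ { zero → p₀? ; (suc v) → ps? v }

≡-irrelevant : ∀ {t} {u v : Fin t} (p q : u ≡ v) → p ≡ q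
≡-irrelevant = UIP.Decidable⇒UIP.≡-irrelevant _≟ᶠ_

module _ {t : ℕ} {A : Fin t → Fin t → Set} where

  walk-++ : ∀ {P u x w l l′} → Walk A P u x l → Walk A P x w l′ → Walk A P u w (l + l′)
  walk-++ (here _) q = q
  walk-++ (step p a r) q = step p a (walk-++ r q)

  walk-start : ∀ {P u w l} → Walk A P u w l → P u
  walk-start (here p) = p
  walk-start (step p _ _) = p

  walk-reverse : (∀ u w → A u w → A w u) →
                 ∀ {P u w l} → Walk A P u w l → ∃[ l′ ] Walk A P w u l′
  walk-reverse sym-A (here p) = _ , here p
  walk-reverse sym-A (step {u} {w} p a r) =
    _ , walk-++ (proj₂ (walk-reverse sym-A r)) (step (walk-start r) (sym-A u w a) (here p))

walk-map : ∀ {t t′} {A : Fin t → Fin t → Set} {B : Fin t′ → Fin t′ → Set}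
           {P : Fin t → Set} {Q : Fin t′ → Set} (g : Fin t → Fin t′) →
           (∀ {u w} → A u w → B (g u) (g w)) → (∀ {u} → P u → Q (g u)) →
           ∀ {u w l} → Walk A P u w l → Walk B Q (g u) (g w) l
walk-map g g-adj g-P (here p) = here (g-P p)
walk-map g g-adj g-P (step p a r) = step (g-P p) (g-adj a) (walk-map g g-adj g-P r)

module TreeProperties {t : ℕ} (T : Tree t) where
  open Tree T

  adjacent-leaves-span : ∀ {p q} → Leaf p → Leaf q → adj p q → ∀ v → v ≡ p ⊎ v ≡ q
  adjacent-leaves-span {p} {q} (_ , _ , p-nb) (_ , _ , q-nb) p~q v =
    stays (inj₁ refl) (proj₂ (connected p v))
    where
      only-q : ∀ w → adj p w → w ≡ q
      only-q w a = trans (p-nb w a) (sym (p-nb q p~q))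
      only-p : ∀ w → adj q w → w ≡ p
      only-p w a = trans (q-nb w a) (sym (q-nb p (adj-sym p q p~q)))
      stays : ∀ {x y l} {P : Fin t → Set} → x ≡ p ⊎ x ≡ q → Walk adj P x y l → y ≡ p ⊎ y ≡ q
      stays x∈ (here _) = x∈
      stays (inj₁ refl) (step _ a r) = stays (inj₂ (only-q _ a)) r
      stays (inj₂ refl) (step _ a r) = stays (inj₁ (only-p _ a)) r

⋃ : ∀ {E : Set} {M} → (Fin M → Sub E) → Sub E
⋃ {M = zero} F = ∅
⋃ {M = suc M} F = F zero ∪ ⋃ (F ∘ suc)

⋃-none : ∀ {E : Set} {M} (F : Fin M → Sub E) e →
         (∀ l → F l e ≡ false) → ⋃ F e ≡ false
⋃-none {M = zero} F e none = refl
⋃-none {M = suc M} F e none rewrite none zero = ⋃-none (F ∘ suc) e (none ∘ suc)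

⋃-only : ∀ {E : Set} {M} (F : Fin M → Sub E) j e →
         (∀ l → l ≢ j → F l e ≡ false) → ⋃ F e ≡ F j e
⋃-only F zero e others
  rewrite ⋃-none (F ∘ suc) e (λ l → others (suc l) λ ()) = BoolP.∨-identityʳ (F zero e)
⋃-only F (suc j) e others
  rewrite others zero (λ ()) =
    ⋃-only (F ∘ suc) j e (λ l l≢j → others (suc l) (l≢j ∘ FinP.suc-injective))

0≤i+i⇒0≤i : ∀ i → + 0 ≤ᶻ i +ᶻ i → + 0 ≤ᶻ i
0≤i+i⇒0≤i (+ _) _ = +≤+ z≤n
0≤i+i⇒0≤i -[1+ _ ] ()

i≤i+j : ∀ {i j} → + 0 ≤ᶻ j → i ≤ᶻ i +ᶻ j
i≤i+j {i} {j} 0≤j = subst (_≤ᶻ i +ᶻ j) (ℤP.+-identityʳ i) (ℤP.+-monoʳ-≤ i 0≤j)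

i≤j+i : ∀ {i j} → + 0 ≤ᶻ j → i ≤ᶻ j +ᶻ i
i≤j+i {i} {j} 0≤j = subst (i ≤ᶻ_) (ℤP.+-comm i j) (i≤i+j 0≤j)

module Connectivity {E : Set} {conn : Sub E → ℤ} (isConn : IsConnectivity conn) where
  open IsConnectivity isConn

  conn-empty : ∀ X → (∀ e → X e ≡ false) → conn X ≡ + 0
  conn-empty X none = trans (ext X ∅ none) empty

  conn-nonneg : ∀ X → + 0 ≤ᶻ conn X
  conn-nonneg X = 0≤i+i⇒0≤i (conn X) (subst₂ _≤ᶻ_ lhs rhs (submod X (∁ X)))
    where
      lhs : conn (X ∪ ∁ X) +ᶻ conn (X ∩ ∁ X) ≡ + 0
      lhs = cong₂ _+ᶻ_
        (trans (ext (X ∪ ∁ X) (∁ ∅) (BoolP.∨-inverseʳ ∘ X)) (trans (sym (symm ∅)) empty))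
        (conn-empty (X ∩ ∁ X) (BoolP.∧-inverseʳ ∘ X))
      rhs : conn X +ᶻ conn (∁ X) ≡ conn X +ᶻ conn X
      rhs = cong (conn X +ᶻ_) (sym (symm X))

  conn-∪ : ∀ X Y → conn (X ∪ Y) ≤ᶻ conn X +ᶻ conn Y
  conn-∪ X Y = ℤP.≤-trans (i≤i+j (conn-nonneg (X ∩ Y))) (submod X Y)

  conn-∩-separation : ∀ X S → conn S ≡ + 0 → conn (X ∩ S) ≤ᶻ conn X
  conn-∩-separation X S S-sep = begin
    conn (X ∩ S)                      ≤⟨ i≤j+i (conn-nonneg (X ∪ S)) ⟩
    conn (X ∪ S) +ᶻ conn (X ∩ S)      ≤⟨ submod X S ⟩
    conn X +ᶻ conn S                  ≡⟨ cong (conn X +ᶻ_) S-sep ⟩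
    conn X +ᶻ + 0                     ≡⟨ ℤP.+-identityʳ (conn X) ⟩
    conn X                            ∎
    where open ℤP.≤-Reasoning

  conn-⋃ : ∀ {M} (F : Fin M → Sub E) → (∀ l → conn (F l) ≡ + 0) → conn (⋃ F) ≡ + 0
  conn-⋃ {zero} F _ = empty
  conn-⋃ {suc M} F F-sep = ℤP.≤-antisym bound (conn-nonneg (⋃ F))
    where
      bound : conn (⋃ F) ≤ᶻ + 0
      bound = ℤP.≤-trans (conn-∪ (F zero) (⋃ (F ∘ suc)))
                (ℤP.≤-reflexive (cong₂ _+ᶻ_ (F-sep zero) (conn-⋃ (F ∘ suc) (F-sep ∘ suc))))

module Blocks {n M : ℕ} (part : Fin n → Fin M) where

  blockSet-∈ : ∀ {e j} → part e ≡ j → blockSet part j e ≡ true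
  blockSet-∈ {e} {j} e∈j with part e ≟ᶠ j
  ... | yes _ = refl
  ... | no e∉j = ⊥-elim (e∉j e∈j)

  blockSet-∉ : ∀ {e j} → part e ≢ j → blockSet part j e ≡ false
  blockSet-∉ {e} {j} e∉j with part e ≟ᶠ j
  ... | yes e∈j = ⊥-elim (e∉j e∈j)
  ... | no _ = refl

  ⋃-blocks : ∀ Z → Z ≗ ⋃ (λ l → Z ∩ blockSet part l)
  ⋃-blocks Z e = sym (begin
    ⋃ (λ l → Z ∩ blockSet part l) e   ≡⟨ ⋃-only _ (part e) e off-block ⟩
    Z e ∧ blockSet part (part e) e     ≡⟨ cong (Z e ∧_) (blockSet-∈ refl) ⟩
    Z e ∧ true                         ≡⟨ BoolP.∧-identityʳ (Z e) ⟩
    Z e                                ∎)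
    where
      open ≡-Reasoning
      off-block : ∀ l → l ≢ part e → Z e ∧ blockSet part l e ≡ false
      off-block l l≢ = trans (cong (Z e ∧_) (blockSet-∉ (l≢ ∘ sym))) (BoolP.∧-zeroʳ (Z e))

  ∩-block-≗-extendSub : ∀ X l → X ∩ blockSet part l ≗ extendSub part l (X ∘ proj₁)
  ∩-block-≗-extendSub X l e with part e ≟ᶠ l
  ... | yes _ = BoolP.∧-identityʳ (X e)
  ... | no _ = BoolP.∧-zeroʳ (X e)

  ConstantOn : Fin M → Sub (Fin n) → Set
  ConstantOn l Z = ∀ e f → part e ≡ l → part f ≡ l → Z e ≡ true → Z f ≡ true

  module _ {conn : Sub (Fin n) → ℤ} (isConn : IsConnectivity conn)
           (blocks-separate : ∀ l → conn (blockSet part l) ≡ + 0) where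
    open IsConnectivity isConn
    open Connectivity isConn

    conn-constant-∩-block : ∀ Z l → ConstantOn l Z → conn (Z ∩ blockSet part l) ≡ + 0
    conn-constant-∩-block Z l Z-const
      with FinP.any? (λ e → (part e ≟ᶠ l) ×-dec (Z e BoolP.≟ true))
    ... | yes (f , f∈l , Zf) = trans (ext _ _ whole) (blocks-separate l)
      where
        whole : Z ∩ blockSet part l ≗ blockSet part l
        whole e with part e ≟ᶠ l
        ... | yes e∈l = trans (BoolP.∧-identityʳ (Z e)) (Z-const f e f∈l e∈l Zf)
        ... | no _ = BoolP.∧-zeroʳ (Z e)
    ... | no nothing = conn-empty _ none
      where
        none : ∀ e → (Z ∩ blockSet part l) e ≡ false
        none e with part e ≟ᶠ l | Z e in Ze
        ... | yes e∈l | true = ⊥-elim (nothing (e , e∈l , Ze))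
        ... | yes _ | false = refl
        ... | no _ | z = BoolP.∧-zeroʳ z

    conn-≤-conn-∩-block : ∀ X j → (∀ l → l ≢ j → ConstantOn l X) →
                          conn X ≤ᶻ conn (X ∩ blockSet part j)
    conn-≤-conn-∩-block X j X-const = begin
      conn X                     ≡⟨ ext X ((X ∩ Bj) ∪ Z) split ⟩
      conn ((X ∩ Bj) ∪ Z)        ≤⟨ conn-∪ (X ∩ Bj) Z ⟩
      conn (X ∩ Bj) +ᶻ conn Z    ≡⟨ cong (conn (X ∩ Bj) +ᶻ_) Z-sep ⟩
      conn (X ∩ Bj) +ᶻ + 0       ≡⟨ ℤP.+-identityʳ _ ⟩
      conn (X ∩ Bj)              ∎
      where
        open ℤP.≤-Reasoning
        Bj = blockSet part j
        Z = X ∩ ∁ Bj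
        split : X ≗ (X ∩ Bj) ∪ Z
        split e with X e | Bj e
        ... | true | true = refl
        ... | true | false = refl
        ... | false | _ = refl
        Z-const : ∀ l → ConstantOn l Z
        Z-const l e f e∈l f∈l Ze with part e ≟ᶠ j | part f ≟ᶠ j | X e in Xe
        Z-const l e f e∈l f∈l () | yes _ | _ | true
        Z-const l e f e∈l f∈l () | _ | _ | false
        ... | no e∉j | yes f∈j | true = ⊥-elim (e∉j (trans e∈l (trans (sym f∈l) f∈j)))
        ... | no e∉j | no _ | true =
              trans (BoolP.∧-identityʳ (X f)) (X-const l (e∉j ∘ trans e∈l) e f e∈l f∈l Xe)
        Z-sep : conn Z ≡ + 0
        Z-sep = trans (ext Z _ (⋃-blocks Z))
                      (conn-⋃ _ (λ l → conn-constant-∩-block Z l (Z-const l)))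

CyclicSucc : ∀ {p} → Fin (suc p) → Fin (suc p) → Set
CyclicSucc {p} k k′ = (∃[ i ] k ≡ inject₁ i × k′ ≡ suc i) ⊎ (k ≡ fromℕ p × k′ ≡ zero)

toℕ-cyclicSucc : ∀ {p} {k k′ : Fin (suc p)} → CyclicSucc k k′ →
                 suc (toℕ k) ≡ toℕ k′ ⊎ (toℕ k ≡ p × toℕ k′ ≡ 0)
toℕ-cyclicSucc (inj₁ (i , refl , refl)) = inj₁ (cong suc (FinP.toℕ-inject₁ i))
toℕ-cyclicSucc {p} (inj₂ (refl , refl)) = inj₂ (FinP.toℕ-fromℕ p , refl)

cyclicSucc-asym : ∀ {m} {k k′ : Fin (suc (suc (suc m)))} → CyclicSucc k k′ → CyclicSucc k′ k → ⊥
cyclicSucc-asym k→k′ k′→k with toℕ-cyclicSucc k→k′ | toℕ-cyclicSucc k′→k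
... | inj₁ e | inj₁ e′ =
  ℕP.1+n≰n (ℕP.≤-trans (ℕP.n≤1+n _) (ℕP.≤-reflexive (trans (cong suc e) e′)))
... | inj₁ e | inj₂ (e′ , k0) with () ← trans (sym e′) (trans (sym e) (cong suc k0))
... | inj₂ (e , k′0) | inj₁ e′ with () ← trans (sym e) (trans (sym e′) (cong suc k′0))
... | inj₂ (_ , k′0) | inj₂ (k′p , _) with () ← trans (sym k′p) k′0

drop-between : ∀ p (h : Fin (suc p) → Bool) a b → a ≤ᶠ b → h a ≡ true → h b ≡ false →
               ∃[ i ] h (inject₁ i) ≡ true × h (suc i) ≡ false
drop-between p h zero zero _ ha hb with () ← trans (sym ha) hb
drop-between (suc p) h zero (suc b) _ ha hb with h (suc zero) in h1
... | false = zero , ha , h1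
... | true = let (i , hi , hi′) = drop-between p (h ∘ suc) zero b z≤n h1 hb in suc i , hi , hi′
drop-between (suc p) h (suc a) (suc b) (s≤s a≤b) ha hb =
  let (i , hi , hi′) = drop-between p (h ∘ suc) a b a≤b ha hb in suc i , hi , hi′

CyclicDrop : ∀ {p} → (Fin (suc p) → Bool) → Set
CyclicDrop h = ∃[ k ] ∃[ k′ ] CyclicSucc k k′ × h k ≡ true × h k′ ≡ false

drop⇒cyclicDrop : ∀ {p} {h : Fin (suc p) → Bool} →
                  ∃[ i ] h (inject₁ i) ≡ true × h (suc i) ≡ false → CyclicDrop h
drop⇒cyclicDrop (i , hi , hi′) = inject₁ i , suc i , inj₁ (i , refl , refl) , hi , hi′

cyclic-drop : ∀ p (h : Fin (suc p) → Bool) a b → h a ≡ true → h b ≡ false → CyclicDrop h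
cyclic-drop p h a b ha hb with FinP.≤-total a b | h zero in h0 | h (fromℕ p) in hℓ
... | inj₁ a≤b | _ | _ = drop⇒cyclicDrop (drop-between p h a b a≤b ha hb)
... | inj₂ _ | true | _ = drop⇒cyclicDrop (drop-between p h zero b z≤n h0 hb)
... | inj₂ _ | false | true = fromℕ p , zero , inj₂ (refl , refl) , hℓ , h0
... | inj₂ _ | false | false =
  drop⇒cyclicDrop (drop-between p h a (fromℕ p) (FinP.≤fromℕ a) ha hℓ)

module Cycles {V : Set} (A : V → V → Set) where

  record IsCycle (m : ℕ) (f : Fin (suc (suc (suc m))) → V) : Set where
    field
      injective : ∀ i j → f i ≡ f j → i ≡ j
      steps     : ∀ (i : Fin (suc (suc m))) → A (f (inject₁ i)) (f (suc i))
      closing   : A (f (fromℕ (suc (suc m)))) (f zero)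

    cyclicSucc-adj : ∀ {k k′} → CyclicSucc k k′ → A (f k) (f k′)
    cyclicSucc-adj (inj₁ (i , refl , refl)) = steps i
    cyclicSucc-adj (inj₂ (refl , refl)) = closing

    cycle-one-sided : (Q : V → Bool) (x₀ y₀ : V) →
                      (∀ x y → A x y → Q x ≡ true → Q y ≡ false → x ≡ x₀ × y ≡ y₀) →
                      (∀ x y → A x y → Q x ≡ false → Q y ≡ true → x ≡ y₀ × y ≡ x₀) →
                      ∀ a b → Q (f a) ≡ true → Q (f b) ≡ false → ⊥
    -- Leaving the Q-side and re-entering it both use the edge x₀y₀, in opposite directions,
    -- so k₁ → k₁′ and k₁′ → k₁ would both be cyclic successions.
    cycle-one-sided Q x₀ y₀ leave enter a b Qa Qb
      with cyclic-drop _ (Q ∘ f) a b Qa Qb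
         | cyclic-drop _ (not ∘ Q ∘ f) b a (cong not Qb) (cong not Qa)
    ... | k₁ , k₁′ , k₁→k₁′ , in₁ , out₁ | k₂ , k₂′ , k₂→k₂′ , out₂ , in₂ =
      cyclicSucc-asym (subst (CyclicSucc k₁) (sym k₂≡k₁′) k₁→k₁′)
                      (subst (CyclicSucc k₂) k₂′≡k₁ k₂→k₂′)
      where
        leaving = leave _ _ (cyclicSucc-adj k₁→k₁′) in₁ out₁
        entering =
          enter _ _ (cyclicSucc-adj k₂→k₂′) (BoolP.not-injective out₂) (BoolP.not-injective in₂)
        k₂′≡k₁ : k₂′ ≡ k₁
        k₂′≡k₁ = injective _ _ (trans (proj₂ entering) (sym (proj₁ leaving)))
        k₂≡k₁′ : k₂ ≡ k₁′
        k₂≡k₁′ = injective _ _ (trans (proj₁ entering) (sym (proj₂ leaving)))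

∑ : ∀ {M} → (Fin M → ℕ) → ℕ
∑ {zero} s = 0
∑ {suc M} s = s zero + ∑ (s ∘ suc)

Σ→Fin : ∀ {M} (s : Fin M → ℕ) → Σ (Fin M) (Fin ∘ s) → Fin (∑ s)
Σ→Fin {suc M} s (zero , v) = v ↑ˡ ∑ (s ∘ suc)
Σ→Fin {suc M} s (suc j , v) = s zero ↑ʳ Σ→Fin (s ∘ suc) (j , v)

Fin→Σ : ∀ {M} (s : Fin M → ℕ) → Fin (∑ s) → Σ (Fin M) (Fin ∘ s)
Fin→Σ {suc M} s x with splitAt (s zero) x
... | inj₁ v = zero , v
... | inj₂ y = let (j , v) = Fin→Σ (s ∘ suc) y in suc j , v

Fin→Σ-Σ→Fin : ∀ {M} (s : Fin M → ℕ) x → Fin→Σ s (Σ→Fin s x) ≡ x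
Fin→Σ-Σ→Fin {suc M} s (zero , v) rewrite FinP.splitAt-↑ˡ (s zero) v (∑ (s ∘ suc)) = refl
Fin→Σ-Σ→Fin {suc M} s (suc j , v)
  rewrite FinP.splitAt-↑ʳ (s zero) (∑ (s ∘ suc)) (Σ→Fin (s ∘ suc) (j , v))
        | Fin→Σ-Σ→Fin (s ∘ suc) (j , v) = refl

Σ→Fin-Fin→Σ : ∀ {M} (s : Fin M → ℕ) y → Σ→Fin s (Fin→Σ s y) ≡ y
Σ→Fin-Fin→Σ {suc M} s y with splitAt (s zero) y in eq
... | inj₁ v = FinP.splitAt⁻¹-↑ˡ eq
... | inj₂ z = trans (cong (s zero ↑ʳ_) (Σ→Fin-Fin→Σ (s ∘ suc) z)) (FinP.splitAt⁻¹-↑ʳ eq)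

Reaches : ∀ {t} → Tree t → Fin t → ℕ → Set
Reaches T c r = ∀ u → ∃[ l ] (l ≤ₙ r × Walk (Tree.adj T) AllV c u l)

-- Restricting a decomposition to a block gives a predecomposition, in which leaves outside the
-- image of σ are allowed; deleting those leaves one by one yields a decomposition of the block.
module Pruning {B : Set} (cn : Sub B → ℤ) (w r : ℕ) where

  record Predecomposition (t : ℕ) : Set₁ where
    field
      tree : Tree t
    open Tree tree public
    field
      σ           : B → Fin t
      σ-inj       : ∀ a b → σ a ≡ σ b → a ≡ b
      σ-leaf      : ∀ a → Leaf (σ a)
      a₁ a₂       : B
      a₁≢a₂       : a₁ ≢ a₂
      σ-nonadjacent : ∀ a b → ¬ adj (σ a) (σ b)
      width       : ∀ v → Internal v → ∀ Y →
                    (∀ a b → SameCompWithout v (σ a) (σ b) → Y a ≡ true → Y b ≡ true) →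
                    cn Y ≤ᶻ + w
      centre      : Fin t
      reach       : Reaches tree centre r

    UnusedLeaf : Fin t → Set
    UnusedLeaf ℓ = Leaf ℓ × (∀ a → σ a ≢ ℓ)

    has-internal : ∃[ v ] Internal v
    has-internal = first-step refl refl (proj₂ (connected (σ a₁) (σ a₂)))
      where
        first-step : ∀ {x y l} → x ≡ σ a₁ → y ≡ σ a₂ → Walk adj AllV x y l → ∃[ v ] Internal v
        first-step x≡ y≡ (here _) = ⊥-elim (a₁≢a₂ (σ-inj _ _ (trans (sym x≡) y≡)))
        first-step refl y≡ (step {w = z} _ a₁~z _) = z , z-internal
          where
            z-internal : Internal z
            z-internal z-leaf
              with TreeProperties.adjacent-leaves-span tree (σ-leaf a₁) z-leaf a₁~z (σ a₂)
            ... | inj₁ e = a₁≢a₂ (σ-inj _ _ (sym e))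
            ... | inj₂ e = σ-nonadjacent a₁ a₂ (subst (adj (σ a₁)) (sym e) a₁~z)

    decomposition : (∀ v → Leaf v → ∃[ a ] σ a ≡ v) → HasDecomp cn w r
    decomposition σ-onto =
      record { size = t ; tree = tree ; σ = σ ; σ-inj = σ-inj ; σ-leaf = σ-leaf
             ; σ-onto = σ-onto ; hasInternal = has-internal }
      , width , centre , reach

  module DeleteLeaf {t : ℕ} (S : Predecomposition (suc t)) (ℓ : Fin (suc t))
                    (ℓ-unused : Predecomposition.UnusedLeaf S ℓ) where
    open Predecomposition S

    u : Fin (suc t)
    u = proj₁ (proj₁ ℓ-unused)

    ℓ~u : adj ℓ u
    ℓ~u = proj₁ (proj₂ (proj₁ ℓ-unused))

    ℓ-nb : ∀ x → adj ℓ x → x ≡ u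
    ℓ-nb = proj₂ (proj₂ (proj₁ ℓ-unused))

    σ≢ℓ : ∀ a → σ a ≢ ℓ
    σ≢ℓ = proj₂ ℓ-unused

    u≢ℓ : u ≢ ℓ
    u≢ℓ u≡ℓ = adj-irr ℓ (subst (adj ℓ) u≡ℓ ℓ~u)

    no-leaf-nb : ∀ z → Leaf z → ¬ adj z ℓ
    no-leaf-nb z z-leaf z~ℓ
      with TreeProperties.adjacent-leaves-span tree z-leaf (proj₁ ℓ-unused) z~ℓ (σ a₁)
         | TreeProperties.adjacent-leaves-span tree z-leaf (proj₁ ℓ-unused) z~ℓ (σ a₂)
    ... | inj₂ e | _ = σ≢ℓ a₁ e
    ... | inj₁ _ | inj₂ e = σ≢ℓ a₂ e
    ... | inj₁ e₁ | inj₁ e₂ = a₁≢a₂ (σ-inj _ _ (trans e₁ (sym e₂)))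

    -- A walk through the leaf ℓ enters and leaves it through u, so that detour can be cut out.
    avoid-ℓ : ∀ {P : Fin (suc t) → Set} {x y l} → Walk adj P x y l → x ≢ ℓ → y ≢ ℓ →
              ∃[ l′ ] (l′ ≤ₙ l × Walk adj (λ z → P z × z ≢ ℓ) x y l′)
    avoid-ℓ (here p) x≢ℓ _ = 0 , z≤n , here (p , x≢ℓ)
    avoid-ℓ (step {w = z} p x~z rest) x≢ℓ y≢ℓ with z ≟ᶠ ℓ
    ... | no z≢ℓ = let (l′ , l′≤ , walk) = avoid-ℓ rest z≢ℓ y≢ℓ in
                   suc l′ , s≤s l′≤ , step (p , x≢ℓ) x~z walk
    avoid-ℓ (step p x~ℓ (here _)) x≢ℓ y≢ℓ | yes refl = ⊥-elim (y≢ℓ refl)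
    avoid-ℓ {x = x} (step p x~ℓ (step _ ℓ~z rest)) x≢ℓ y≢ℓ | yes refl =
      let (l′ , l′≤ , walk) = avoid-ℓ rest (x≢ℓ ∘ trans (sym z≡x)) y≢ℓ in
      l′ , ℕP.≤-trans l′≤ (ℕP.≤-trans (ℕP.n≤1+n _) (ℕP.n≤1+n _)) ,
      subst (λ q → Walk adj _ q _ l′) z≡x walk
      where
        z≡x = trans (ℓ-nb _ ℓ~z) (sym (ℓ-nb x (adj-sym x ℓ x~ℓ)))

    adj⁻ : Fin t → Fin t → Set
    adj⁻ a b = adj (punchIn ℓ a) (punchIn ℓ b)

    punchOut-walk : ∀ {P : Fin (suc t) → Set} {Q : Fin t → Set} →
                    (∀ c → P (punchIn ℓ c) → Q c) →
                    ∀ {x y l} → Walk adj (λ z → P z × z ≢ ℓ) x y l →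
                    ∀ a b → punchIn ℓ a ≡ x → punchIn ℓ b ≡ y → Walk adj⁻ Q a b l
    punchOut-walk f (here (p , _)) a b refl b≡ =
      subst (λ q → Walk adj⁻ _ a q 0) (FinP.punchIn-injective ℓ a b (sym b≡)) (here (f a p))
    punchOut-walk f (step {w = z} (p , _) x~z rest) a b refl b≡ =
      step (f a p) (subst (adj (punchIn ℓ a)) (sym (FinP.punchIn-punchOut ℓ≢z)) x~z)
           (punchOut-walk f rest (punchOut ℓ≢z) b (FinP.punchIn-punchOut ℓ≢z) b≡)
      where
        ℓ≢z : ℓ ≢ z
        ℓ≢z = proj₂ (walk-start rest) ∘ sym

    shorten : ∀ {P : Fin (suc t) → Set} {Q : Fin t → Set} →
              (∀ c → P (punchIn ℓ c) → Q c) →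
              ∀ {a b l} → Walk adj P (punchIn ℓ a) (punchIn ℓ b) l →
              ∃[ l′ ] (l′ ≤ₙ l × Walk adj⁻ Q a b l′)
    shorten f {a} {b} walk =
      let (l′ , l′≤ , walk′) = avoid-ℓ walk (FinP.punchInᵢ≢i ℓ a) (FinP.punchInᵢ≢i ℓ b)
      in l′ , l′≤ , punchOut-walk f walk′ a b refl refl

    tree⁻ : Tree t
    tree⁻ = record
      { adj = adj⁻
      ; adj-sym = λ a b → adj-sym _ _
      ; adj-irr = λ a → adj-irr _
      ; connected = λ a b →
          let (l , _ , walk) = shorten (λ _ _ → tt) (proj₂ (connected _ _)) in l , walk
      ; acyclic = λ m f f-inj f-steps f-closing →
          acyclic m (punchIn ℓ ∘ f) (λ i j e → f-inj i j (FinP.punchIn-injective ℓ _ _ e))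
                  f-steps f-closing
      }

    leaf⁻ : ∀ z → Leaf (punchIn ℓ z) → Tree.Leaf tree⁻ z
    leaf⁻ z (x , z~x , z-nb) =
      punchOut ℓ≢x , subst (adj (punchIn ℓ z)) (sym (FinP.punchIn-punchOut ℓ≢x)) z~x ,
      λ y z~y → FinP.punchIn-injective ℓ _ _
                  (trans (z-nb _ z~y) (sym (FinP.punchIn-punchOut ℓ≢x)))
      where
        ℓ≢x : ℓ ≢ x
        ℓ≢x ℓ≡x = no-leaf-nb (punchIn ℓ z) (x , z~x , z-nb) (subst (adj _) (sym ℓ≡x) z~x)

    σ⁻ : B → Fin t
    σ⁻ a = punchOut (σ≢ℓ a ∘ sym)

    punchIn-σ⁻ : ∀ a → punchIn ℓ (σ⁻ a) ≡ σ a
    punchIn-σ⁻ a = FinP.punchIn-punchOut _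

    centre⁻ : Fin t
    centre⁻ with centre ≟ᶠ ℓ
    ... | yes _ = punchOut (u≢ℓ ∘ sym)
    ... | no c≢ℓ = punchOut (c≢ℓ ∘ sym)

    centre⁻-reach : ∀ y → y ≢ ℓ → ∃[ l ] (l ≤ₙ r × Walk adj AllV (punchIn ℓ centre⁻) y l)
    centre⁻-reach y y≢ℓ with centre ≟ᶠ ℓ | reach y
    ... | no _ | l , l≤r , walk =
          l , l≤r , subst (λ x → Walk adj AllV x y l) (sym (FinP.punchIn-punchOut _)) walk
    ... | yes c≡ℓ | _ , _ , here _ = ⊥-elim (y≢ℓ c≡ℓ)
    ... | yes c≡ℓ | suc l , l<r , step _ c~z rest =
          l , ℕP.≤-trans (ℕP.n≤1+n l) l<r ,
          subst (λ x → Walk adj AllV x y l)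
                (trans (ℓ-nb _ (subst (λ x → adj x _) c≡ℓ c~z)) (sym (FinP.punchIn-punchOut _)))
                rest

    predecomposition⁻ : Predecomposition t
    predecomposition⁻ = record
      { tree = tree⁻
      ; σ = σ⁻
      ; σ-inj = λ a b e →
          σ-inj a b (trans (sym (punchIn-σ⁻ a)) (trans (cong (punchIn ℓ) e) (punchIn-σ⁻ b)))
      ; σ-leaf = λ a → leaf⁻ (σ⁻ a) (subst Leaf (sym (punchIn-σ⁻ a)) (σ-leaf a))
      ; a₁ = a₁ ; a₂ = a₂ ; a₁≢a₂ = a₁≢a₂
      ; σ-nonadjacent = λ a b a~b →
          σ-nonadjacent a b (subst₂ adj (punchIn-σ⁻ a) (punchIn-σ⁻ b) a~b)
      ; width = width⁻
      ; centre = centre⁻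
      ; reach = λ y →
          let (l , l≤r , walk) = centre⁻-reach (punchIn ℓ y) (FinP.punchInᵢ≢i ℓ y)
              (l′ , l′≤l , walk′) = shorten (λ _ _ → tt) walk
          in l′ , ℕP.≤-trans l′≤l l≤r , walk′
      }
      where
        width⁻ : ∀ v → Tree.Internal tree⁻ v → ∀ Y →
                 (∀ a b → Tree.SameCompWithout tree⁻ v (σ⁻ a) (σ⁻ b) →
                          Y a ≡ true → Y b ≡ true) →
                 cn Y ≤ᶻ + w
        width⁻ v v-internal Y Y-closed = width (punchIn ℓ v) (v-internal ∘ leaf⁻ v) Y Y-closed′
          where
            Y-closed′ : ∀ a b → SameCompWithout (punchIn ℓ v) (σ a) (σ b) →
                        Y a ≡ true → Y b ≡ true
            Y-closed′ a b (_ , walk) =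
              let walk-σ⁻ = subst₂ (λ x y → Walk adj _ x y _)
                                   (sym (punchIn-σ⁻ a)) (sym (punchIn-σ⁻ b)) walk
                  (_ , _ , walk′) = shorten (λ _ z≢ e → z≢ (cong (punchIn ℓ) e)) walk-σ⁻
              in Y-closed a b (_ , walk′)

  -- Having an unused leaf is not decidable, so pruning only succeeds under double negation.
  prune : ∀ {t} → Predecomposition t → ¬ ¬ HasDecomp cn w r
  prune {zero} S _ with Predecomposition.σ S (Predecomposition.a₁ S)
  ... | ()
  prune {suc t} S no-decomp = ¬¬-excluded-middle {A = ∃ UnusedLeaf} λ where
      (yes (ℓ , ℓ-unused)) → prune (DeleteLeaf.predecomposition⁻ S ℓ ℓ-unused) no-decomp
      (no no-unused) → ¬¬-decidable (suc t) (λ v → ∃[ a ] σ a ≡ v) λ preimage? →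
        no-decomp (decomposition (σ-onto preimage? no-unused))
    where
      open Predecomposition S
      σ-onto : (∀ v → Dec (∃[ a ] σ a ≡ v)) → ¬ ∃ UnusedLeaf →
               ∀ v → Leaf v → ∃[ a ] σ a ≡ v
      σ-onto preimage? no-unused v v-leaf with preimage? v
      ... | yes found = found
      ... | no none = ⊥-elim (no-unused (v , v-leaf , λ a σa≡v → none (a , σa≡v)))

module Recentre {E : Set} (D : Decomposition E) where
  open Decomposition D

  -- Other trees are glued on at the centre, so it must not be a leaf;
  -- when the radius is positive, a leaf centre can be moved to its neighbour.
  internal-centre : E → ∀ {r} → 1 ≤ₙ r → ∀ c → Dec (∃[ e ] σ e ≡ c) → Reaches tree c r →
                    Σ (Fin size) λ c′ → Internal c′ × (∃[ x ] adj c′ x) × Reaches tree c′ r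
  internal-centre e₀ _ c (no c-unused) c-reach =
    c , c-internal , first-step refl (proj₂ (connected c (σ e₀))) , c-reach
    where
      c-internal : Internal c
      c-internal c-leaf = let (e , σe≡c) = σ-onto c c-leaf in c-unused (e , σe≡c)
      first-step : ∀ {x l} → x ≡ c → Walk adj AllV x (σ e₀) l → ∃[ y ] adj c y
      first-step x≡c (here _) = ⊥-elim (c-unused (e₀ , x≡c))
      first-step refl (step _ c~y _) = _ , c~y
  internal-centre e₀ 1≤r c (yes (e , σe≡c)) c-reach =
    u , u-internal , (c , adj-sym _ _ c~u) , u-reach
    where
      c-leaf : Leaf c
      c-leaf = subst Leaf σe≡c (σ-leaf e)
      u = proj₁ c-leaf
      c~u = proj₁ (proj₂ c-leaf)
      u-internal : Internal u
      u-internal u-leaf with hasInternal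
      ... | v , v-internal with TreeProperties.adjacent-leaves-span tree c-leaf u-leaf c~u v
      ...   | inj₁ refl = v-internal c-leaf
      ...   | inj₂ refl = v-internal u-leaf
      u-reach : Reaches tree u _
      u-reach x with x ≟ᶠ c | c-reach x
      ... | yes refl | _ = 1 , 1≤r , step tt (adj-sym _ _ c~u) (here tt)
      ... | no x≢c | _ , _ , here _ = ⊥-elim (x≢c refl)
      ... | no _ | suc l , l<r , step _ c~y rest =
            l , ℕP.≤-trans (ℕP.n≤1+n l) l<r ,
            subst (λ z → Walk adj AllV z x l) (proj₂ (proj₂ c-leaf) _ c~y) rest

does-≟-true : ∀ {M} (a b : Fin M) → does (a ≟ᶠ b) ≡ true → a ≡ b
does-≟-true a b holds with a ≟ᶠ b
... | yes a≡b = a≡b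

module Gluing {n M : ℕ} (part : Fin n → Fin M) where

  record BlockTree (j : Fin M) (depth : ℕ) : Set₁ where
    field
      size   : ℕ
      tree   : Tree size
      centre : Fin size
      σ      : ∀ e → .(part e ≡ j) → Fin size
      σ-inj  : ∀ e f .(p : part e ≡ j) .(q : part f ≡ j) → σ e p ≡ σ f q → e ≡ f
      reach  : Reaches tree centre depth
    open Tree tree public

  record Proper (conn : Sub (Fin n) → ℤ) (w : ℕ) {j d} (B : BlockTree j d) : Set where
    open BlockTree B
    field
      centre-internal : Internal centre
      centre-nb       : ∃[ x ] adj centre x
      σ-leaf          : ∀ e .(p : part e ≡ j) → Leaf (σ e p)
      σ-onto          : ∀ v → Leaf v → Σ (Fin n) λ e → Σ (part e ≡ j) λ p → σ e p ≡ v
      width           : ∀ v → Internal v → ∀ X →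
                        (∀ e f (p : part e ≡ j) (q : part f ≡ j) →
                           SameCompWithout v (σ e p) (σ f q) → X e ≡ true → X f ≡ true) →
                        conn (X ∩ blockSet part j) ≤ᶻ + w

  Proper-widen : ∀ {conn w w′ j d} {B : BlockTree j d} →
                 w ≤ₙ w′ → Proper conn w B → Proper conn w′ B
  Proper-widen w≤w′ P = record
    { centre-internal = centre-internal ; centre-nb = centre-nb ; σ-leaf = σ-leaf ; σ-onto = σ-onto
    ; width = λ v v-internal X X-closed → ℤP.≤-trans (width v v-internal X X-closed) (+≤+ w≤w′) }
    where open Proper P

  -- The tree of a block with fewer than two elements.
  record Point {j d} (B : BlockTree j d) : Set where
    open BlockTree B
    field
      no-edge : ∀ u v → ¬ adj u v
      single  : ∀ v → v ≡ centre

  module Glue {conn : Sub (Fin n) → ℤ} (isConn : IsConnectivity conn)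
              (blocks-separate : ∀ l → conn (blockSet part l) ≡ + 0)
              (w : ℕ) (hub : Fin M) (depth : Fin M → ℕ) (block : ∀ j → BlockTree j (depth j))
              (kind : ∀ j → Proper conn w (block j) ⊎ Point (block j))
              (point-inhabited : ∀ j → Point (block j) → j ≢ hub → ∃[ e ] part e ≡ j)
              (point-hub : ∀ j → Point (block j) → j ≡ hub →
                           (∀ e → part e ≢ j) ×
                           ∃[ j₁ ] ∃[ j₂ ] j₁ ≢ j₂ × j₁ ≢ hub × j₂ ≢ hub)
              (R : ℕ) (hub-depth : depth hub ≤ₙ R)
              (spoke-depth : ∀ j → j ≢ hub → suc (depth j) ≤ₙ R) where

    sz : Fin M → ℕ
    sz j = BlockTree.size (block j)

    c : ∀ j → Fin (sz j)
    c j = BlockTree.centre (block j)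

    σᵇ : ∀ j e → .(part e ≡ j) → Fin (sz j)
    σᵇ j = BlockTree.σ (block j)

    adjᵇ : ∀ j → Fin (sz j) → Fin (sz j) → Set
    adjᵇ j = BlockTree.adj (block j)

    Leafᵇ : ∀ j → Fin (sz j) → Set
    Leafᵇ j = BlockTree.Leaf (block j)

    Vertex : Set
    Vertex = Σ (Fin M) (Fin ∘ sz)

    hub-vertex : Vertex
    hub-vertex = hub , c hub

    data _~_ : Vertex → Vertex → Set where
      inside : ∀ {j u v} → adjᵇ j u v → (j , u) ~ (j , v)
      spoke  : ∀ {j} → j ≢ hub → hub-vertex ~ (j , c j)
      spoke⁻ : ∀ {j} → j ≢ hub → (j , c j) ~ hub-vertex

    ~-sym : ∀ {x y} → x ~ y → y ~ x
    ~-sym (inside {j} u~v) = inside (BlockTree.adj-sym (block j) _ _ u~v)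
    ~-sym (spoke j≢hub) = spoke⁻ j≢hub
    ~-sym (spoke⁻ j≢hub) = spoke j≢hub

    ~-irrefl : ∀ {x} → ¬ x ~ x
    ~-irrefl (inside {j} u~u) = BlockTree.adj-irr (block j) _ u~u
    ~-irrefl (spoke j≢hub) = j≢hub refl
    ~-irrefl (spoke⁻ j≢hub) = j≢hub refl

    ~-inside⁻¹ : ∀ {j u v} → (j , u) ~ (j , v) → adjᵇ j u v
    ~-inside⁻¹ (inside u~v) = u~v
    ~-inside⁻¹ (spoke j≢hub) = ⊥-elim (j≢hub refl)
    ~-inside⁻¹ (spoke⁻ j≢hub) = ⊥-elim (j≢hub refl)

    ~-off-centre : ∀ {j v y} → v ≢ c j → (j , v) ~ y →
                   Σ (Fin (sz j)) λ u → y ≡ (j , u) × adjᵇ j v u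
    ~-off-centre _ (inside {v = u} v~u) = u , refl , v~u
    ~-off-centre v≢c (spoke _) = ⊥-elim (v≢c refl)
    ~-off-centre v≢c (spoke⁻ _) = ⊥-elim (v≢c refl)

    ,-injʳ : ∀ {j u v} → (Vertex ∋ (j , u)) ≡ (j , v) → u ≡ v
    ,-injʳ = ProdP.,-injectiveʳ-UIP ≡-irrelevant

    LeafV : Vertex → Set
    LeafV x = Σ Vertex λ y → x ~ y × (∀ z → x ~ z → z ≡ y)

    leaf-off-centre : ∀ {j v} → v ≢ c j → Leafᵇ j v → LeafV (j , v)
    leaf-off-centre {j} v≢c (u , v~u , v-nb) = (j , u) , inside v~u , λ z v~z →
      let (u′ , z≡ , v~u′) = ~-off-centre v≢c v~z in trans z≡ (cong (j ,_) (v-nb u′ v~u′))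

    leaf-off-centre⁻¹ : ∀ {j v} → v ≢ c j → LeafV (j , v) → Leafᵇ j v
    leaf-off-centre⁻¹ {j} v≢c (y , v~y , v-nb) with ~-off-centre v≢c v~y
    ... | u , refl , v~u = u , v~u , λ u′ v~u′ → ,-injʳ (v-nb (j , u′) (inside v~u′))

    proper-centre-internal : ∀ {j} → Proper conn w (block j) → ¬ LeafV (j , c j)
    proper-centre-internal {j} P (y , c~y , c-nb) =
      Proper.centre-internal P
        (u , c~u , λ u′ c~u′ → ,-injʳ (trans (c-nb _ (inside c~u′)) (sym y≡u)))
      where
        u = proj₁ (Proper.centre-nb P)
        c~u = proj₂ (Proper.centre-nb P)
        y≡u = c-nb _ (inside c~u)

    point-spoke-leaf : ∀ {j} → Point (block j) → j ≢ hub → LeafV (j , c j)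
    point-spoke-leaf {j} P j≢hub = hub-vertex , spoke⁻ j≢hub , only-hub
      where
        only-hub : ∀ z → (j , c j) ~ z → z ≡ hub-vertex
        only-hub z (inside c~u) = ⊥-elim (Point.no-edge P _ _ c~u)
        only-hub z (spoke _) = ⊥-elim (j≢hub refl)
        only-hub z (spoke⁻ _) = refl

    point-hub-internal : Point (block hub) → ¬ LeafV hub-vertex
    point-hub-internal P (y , hub~y , hub-nb) =
      let (j₁ , j₂ , j₁≢j₂ , j₁≢hub , j₂≢hub) = proj₂ (point-hub hub P refl)
      in j₁≢j₂ (ProdP.,-injectiveˡ
                 (trans (hub-nb _ (spoke j₁≢hub)) (sym (hub-nb _ (spoke j₂≢hub)))))

    T : ℕ
    T = ∑ sz

    index : Vertex → Fin T
    index = Σ→Fin sz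

    vertex : Fin T → Vertex
    vertex = Fin→Σ sz

    _~ᵀ_ : Fin T → Fin T → Set
    a ~ᵀ b = vertex a ~ vertex b

    ~⇒~ᵀ : ∀ {x y} → x ~ y → index x ~ᵀ index y
    ~⇒~ᵀ = subst₂ _~_ (sym (Fin→Σ-Σ→Fin sz _)) (sym (Fin→Σ-Σ→Fin sz _))

    index-injective : ∀ {x y} → index x ≡ index y → x ≡ y
    index-injective {x} {y} e =
      trans (sym (Fin→Σ-Σ→Fin sz x)) (trans (cong vertex e) (Fin→Σ-Σ→Fin sz y))

    embed-walk : ∀ j {P : Fin (sz j) → Set} {Q : Fin T → Set} → (∀ {v} → P v → Q (index (j , v))) →
                 ∀ {u v l} → Walk (adjᵇ j) P u v l → Walk _~ᵀ_ Q (index (j , u)) (index (j , v)) l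
    embed-walk j = walk-map (λ v → index (j , v)) (~⇒~ᵀ ∘ inside)

    hub-reach-vertex : ∀ x → ∃[ l ] (l ≤ₙ R × Walk _~ᵀ_ AllV (index hub-vertex) (index x) l)
    hub-reach-vertex (j , v) with j ≟ᶠ hub
    ... | yes refl = let (l , l≤ , walk) = BlockTree.reach (block hub) v
                     in l , ℕP.≤-trans l≤ hub-depth , embed-walk hub _ walk
    ... | no j≢hub = let (l , l≤ , walk) = BlockTree.reach (block j) v
                     in suc l , ℕP.≤-trans (s≤s l≤) (spoke-depth j j≢hub) ,
                        step tt (~⇒~ᵀ (spoke j≢hub)) (embed-walk j _ walk)

    hub-reach : ∀ a → ∃[ l ] (l ≤ₙ R × Walk _~ᵀ_ AllV (index hub-vertex) a l)
    hub-reach a = let (l , l≤ , walk) = hub-reach-vertex (vertex a)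
                  in l , l≤ , subst (λ b → Walk _~ᵀ_ AllV _ b l) (Σ→Fin-Fin→Σ sz a) walk

    inBlock : Fin M → Vertex → Bool
    inBlock l x = does (proj₁ x ≟ᶠ l)

    leave-block : ∀ l → l ≢ hub → ∀ x y → x ~ y → inBlock l x ≡ true → inBlock l y ≡ false →
                  x ≡ (l , c l) × y ≡ hub-vertex
    leave-block l l≢hub _ _ (inside _) in-x out-y with () ← trans (sym in-x) out-y
    leave-block l l≢hub _ _ (spoke _) in-x _ = ⊥-elim (l≢hub (sym (does-≟-true hub l in-x)))
    leave-block l l≢hub _ _ (spoke⁻ {j} _) in-x _ with refl ← does-≟-true j l in-x = refl , refl

    enter-block : ∀ l → l ≢ hub → ∀ x y → x ~ y → inBlock l x ≡ false → inBlock l y ≡ true →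
                  x ≡ hub-vertex × y ≡ (l , c l)
    enter-block l l≢hub _ _ (inside _) out-x in-y with () ← trans (sym in-y) out-x
    enter-block l l≢hub _ _ (spoke {j} _) _ in-y with refl ← does-≟-true j l in-y = refl , refl
    enter-block l l≢hub _ _ (spoke⁻ _) _ in-y = ⊥-elim (l≢hub (sym (does-≟-true hub l in-y)))

    local : ∀ j (x : Vertex) → proj₁ x ≡ j → Fin (sz j)
    local j (.j , v) refl = v

    local-≡ : ∀ j (x : Vertex) (x∈j : proj₁ x ≡ j) → x ≡ (j , local j x x∈j)
    local-≡ j (.j , v) refl = refl

    module _ {m g} (C : Cycles.IsCycle _~_ m g) where
      open Cycles.IsCycle C

      cycle-in-block : ∀ j → (∀ k → proj₁ (g k) ≡ j) → ⊥
      cycle-in-block j in-j =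
        BlockTree.acyclic (block j) m g-local g-local-inj (g-local-adj ∘ steps) (g-local-adj closing)
        where
          g-local : Fin (suc (suc (suc m))) → Fin (sz j)
          g-local k = local j (g k) (in-j k)
          g≡ : ∀ k → g k ≡ (j , g-local k)
          g≡ k = local-≡ j (g k) (in-j k)
          g-local-inj : ∀ a b → g-local a ≡ g-local b → a ≡ b
          g-local-inj a b e = injective a b (trans (g≡ a) (trans (cong (j ,_) e) (sym (g≡ b))))
          g-local-adj : ∀ {a b} → g a ~ g b → adjᵇ j (g-local a) (g-local b)
          g-local-adj {a} {b} = ~-inside⁻¹ ∘ subst₂ _~_ (g≡ a) (g≡ b)

      -- The only edge leaving a non-hub block is its spoke, which a cycle cannot use.
      no-exit : ∀ l → l ≢ hub → ∀ a b → proj₁ (g a) ≡ l → proj₁ (g b) ≢ l → ⊥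
      no-exit l l≢hub a b a∈l b∉l =
        cycle-one-sided (inBlock l) _ _ (leave-block l l≢hub) (enter-block l l≢hub) a b
                        (dec-true (proj₁ (g a) ≟ᶠ l) a∈l) (dec-false (proj₁ (g b) ≟ᶠ l) b∉l)

      cycle-stays : ∀ k → proj₁ (g k) ≡ proj₁ (g zero)
      cycle-stays k with proj₁ (g k) ≟ᶠ proj₁ (g zero) | proj₁ (g zero) ≟ᶠ hub
      ... | yes same | _ = same
      ... | no differ | no g₀≢hub = ⊥-elim (no-exit _ g₀≢hub zero k refl differ)
      ... | no differ | yes g₀≡hub =
            ⊥-elim (no-exit _ (λ gₖ≡hub → differ (trans gₖ≡hub (sym g₀≡hub)))
                            k zero refl (differ ∘ sym))

      no-cycle : ⊥
      no-cycle = cycle-in-block (proj₁ (g zero)) cycle-stays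

    glued-tree : Tree T
    glued-tree = record
      { adj = _~ᵀ_
      ; adj-sym = λ _ _ → ~-sym
      ; adj-irr = λ _ → ~-irrefl
      ; connected = λ a b →
          let (_ , _ , to-a) = hub-reach a
              (_ , _ , to-b) = hub-reach b
              (_ , from-a) = walk-reverse (λ _ _ → ~-sym) to-a
          in _ , walk-++ from-a to-b
      ; acyclic = λ m f f-inj f-steps f-closing → no-cycle {m} {vertex ∘ f} record
          { injective = λ a b e → f-inj a b (trans (sym (Σ→Fin-Fin→Σ sz (f a)))
                                     (trans (cong index e) (Σ→Fin-Fin→Σ sz (f b))))
          ; steps = f-steps
          ; closing = f-closing }
      }

    LeafT : Fin T → Set
    LeafT = Tree.Leaf glued-tree

    leafᵀ⇒leafV : ∀ {a} → LeafT a → LeafV (vertex a)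
    leafᵀ⇒leafV (b , a~b , a-nb) = vertex b , a~b , λ z a~z →
      trans (sym (Fin→Σ-Σ→Fin sz z))
            (cong vertex (a-nb (index z) (subst (_ ~_) (sym (Fin→Σ-Σ→Fin sz z)) a~z)))

    leafV⇒leafᵀ : ∀ {x} → LeafV x → LeafT (index x)
    leafV⇒leafᵀ {x} (y , x~y , x-nb) = index y , ~⇒~ᵀ x~y , λ b x~b →
      trans (sym (Σ→Fin-Fin→Σ sz b))
            (cong index (x-nb (vertex b) (subst (_~ _) (Fin→Σ-Σ→Fin sz x) x~b)))

    σᵀ : Fin n → Fin T
    σᵀ e = index (part e , σᵇ (part e) e refl)

    σᵀ-at : ∀ j e (p : part e ≡ j) → σᵀ e ≡ index (j , σᵇ j e p)
    σᵀ-at _ e refl = refl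

    subst-σᵇ : ∀ {j j′} (q : j ≡ j′) e .(p : part e ≡ j) →
               subst (Fin ∘ sz) q (σᵇ j e p) ≡ σᵇ j′ e (trans p q)
    subst-σᵇ refl e p = refl

    σᵀ-inj : ∀ e f → σᵀ e ≡ σᵀ f → e ≡ f
    σᵀ-inj e f σe≡σf =
      BlockTree.σ-inj (block (part f)) e f (trans refl q) refl
        (trans (sym (subst-σᵇ q e refl)) (ProdP.,-injectiveʳ-≡ ≡-irrelevant same-vertex q))
      where
        same-vertex = index-injective σe≡σf
        q = ProdP.,-injectiveˡ same-vertex

    σ-leafV : ∀ e → LeafV (part e , σᵇ (part e) e refl)
    σ-leafV e with kind (part e)
    ... | inj₁ P = leaf-off-centre σ≢c (Proper.σ-leaf P e refl)
      where
        σ≢c : σᵇ (part e) e refl ≢ c (part e)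
        σ≢c σ≡c = Proper.centre-internal P (subst (Leafᵇ (part e)) σ≡c (Proper.σ-leaf P e refl))
    ... | inj₂ P with part e ≟ᶠ hub
    ...   | yes e∈hub = ⊥-elim (proj₁ (point-hub (part e) P e∈hub) e refl)
    ...   | no e∉hub =
            subst (λ v → LeafV (part e , v)) (sym (Point.single P _)) (point-spoke-leaf P e∉hub)

    σ-onto-vertex : ∀ x → LeafV x → ∃[ e ] σᵀ e ≡ index x
    σ-onto-vertex (j , v) x-leaf with kind j
    ... | inj₁ P with v ≟ᶠ c j
    ...   | yes v≡c = ⊥-elim (proper-centre-internal P (subst (λ u → LeafV (j , u)) v≡c x-leaf))
    ...   | no v≢c = let (e , p , σe≡v) = Proper.σ-onto P v (leaf-off-centre⁻¹ v≢c x-leaf)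
                     in e , trans (σᵀ-at j e p) (cong (λ u → index (j , u)) σe≡v)
    σ-onto-vertex (j , v) x-leaf | inj₂ P with j ≟ᶠ hub
    ...   | yes refl =
            ⊥-elim (point-hub-internal P (subst (λ u → LeafV (hub , u)) (Point.single P v) x-leaf))
    ...   | no j≢hub =
            let (e , p) = point-inhabited j P j≢hub
            in e , trans (σᵀ-at j e p)
                         (cong (λ u → index (j , u)) (trans (Point.single P _) (sym (Point.single P v))))

    hub-internal : ¬ LeafT (index hub-vertex)
    hub-internal hub-leaf =
      [ (λ P → proper-centre-internal P leaf) , (λ P → point-hub-internal P leaf) ]′ (kind hub)
      where
        leaf = subst LeafV (Fin→Σ-Σ→Fin sz hub-vertex) (leafᵀ⇒leafV hub-leaf)

    UnionOfPartsᵀ : Fin T → Sub (Fin n) → Set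
    UnionOfPartsᵀ a X =
      ∀ e f → Tree.SameCompWithout glued-tree a (σᵀ e) (σᵀ f) → X e ≡ true → X f ≡ true

    module Width (j : Fin M) (v : Fin (sz j)) (internal : ¬ LeafT (index (j , v)))
                 (X : Sub (Fin n)) (X-closed : UnionOfPartsᵀ (index (j , v)) X) where
      open Connectivity isConn
      open Blocks part

      closed-in-block : ∀ l e f (p : part e ≡ l) (q : part f ≡ l) {P : Fin (sz l) → Set} {len} →
                        (∀ {u} → P u → index (l , u) ≢ index (j , v)) →
                        Walk (adjᵇ l) P (σᵇ l e p) (σᵇ l f q) len → X e ≡ true → X f ≡ true
      closed-in-block l e f p q avoid walk =
        X-closed e f (_ , subst₂ (λ a b → Walk _~ᵀ_ _ a b _) (sym (σᵀ-at l e p)) (sym (σᵀ-at l f q))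
                                 (embed-walk l avoid walk))

      constant-off-j : ∀ l → l ≢ j → ConstantOn l X
      constant-off-j l l≢j e f p q =
        closed-in-block l e f p q (λ {u} _ → l≢j ∘ ProdP.,-injectiveˡ ∘ index-injective)
                        (proj₂ (BlockTree.connected (block l) _ _))

      bound-on-j : conn (X ∩ blockSet part j) ≤ᶻ + w
      bound-on-j with kind j
      ... | inj₁ P = Proper.width P v v-internal X λ e f p q (_ , walk) →
                       closed-in-block j e f p q (λ u≢v → u≢v ∘ ,-injʳ ∘ index-injective) walk
        where
          v-internal : BlockTree.Internal (block j) v
          v-internal v-leaf with v ≟ᶠ c j
          ... | yes v≡c = Proper.centre-internal P (subst (Leafᵇ j) v≡c v-leaf)
          ... | no v≢c = internal (leafV⇒leafᵀ (leaf-off-centre v≢c v-leaf))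
      ... | inj₂ P with j ≟ᶠ hub
      ...   | no j≢hub =
              ⊥-elim (internal (leafV⇒leafᵀ
                (subst (λ u → LeafV (j , u)) (sym (Point.single P v)) (point-spoke-leaf P j≢hub))))
      ...   | yes j≡hub = ℤP.≤-trans (ℤP.≤-reflexive (conn-empty _ none)) (+≤+ z≤n)
        where
          none : ∀ e → (X ∩ blockSet part j) e ≡ false
          none e =
            trans (cong (X e ∧_) (blockSet-∉ (proj₁ (point-hub j P j≡hub) e))) (BoolP.∧-zeroʳ (X e))

      bound : conn X ≤ᶻ + w
      bound = ℤP.≤-trans (conn-≤-conn-∩-block isConn blocks-separate X j constant-off-j) bound-on-j

    glued-decomposition : HasDecomp conn w R
    glued-decomposition =
      record { size = T ; tree = glued-tree ; σ = σᵀ ; σ-inj = σᵀ-inj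
             ; σ-leaf = leafV⇒leafᵀ ∘ σ-leafV
             ; σ-onto = λ a a-leaf → subst (λ b → ∃[ e ] σᵀ e ≡ b) (Σ→Fin-Fin→Σ sz a)
                                          (σ-onto-vertex (vertex a) (leafᵀ⇒leafV a-leaf))
             ; hasInternal = index hub-vertex , hub-internal }
      , width
      , index hub-vertex , hub-reach
      where
        width : ∀ a → Tree.Internal glued-tree a → ∀ X → UnionOfPartsᵀ a X → conn X ≤ᶻ + w
        width a a-internal X X-closed =
          Width.bound (proj₁ (vertex a)) (proj₂ (vertex a)) (subst (¬_ ∘ LeafT) (sym a≡) a-internal) X
                      (subst (λ b → UnionOfPartsᵀ b X) (sym a≡) X-closed)
          where
            a≡ : index (vertex a) ≡ a
            a≡ = Σ→Fin-Fin→Σ sz a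

m≤n≤1+m⇒n≡m⊎n≡1+m : ∀ {m n} → m ≤ₙ n → n ≤ₙ suc m → n ≡ m ⊎ n ≡ suc m
m≤n≤1+m⇒n≡m⊎n≡1+m m≤n n≤1+m with ℕP.m≤n⇒m<n∨m≡n m≤n
... | inj₁ m<n = inj₂ (ℕP.≤-antisym n≤1+m m<n)
... | inj₂ m≡n = inj₁ (sym m≡n)

maxF-upper : ∀ {m} (f : Fin m → ℕ) i → f i ≤ₙ maxF f
maxF-upper f zero = ℕP.m≤m⊔n _ _
maxF-upper f (suc i) = ℕP.≤-trans (maxF-upper (f ∘ suc) i) (ℕP.m≤n⊔m _ _)

maxF-least : ∀ {m} (f : Fin m → ℕ) {b} → (∀ i → f i ≤ₙ b) → maxF f ≤ₙ b
maxF-least {zero} f _ = z≤n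
maxF-least {suc m} f f≤b = ℕP.⊔-lub (f≤b zero) (maxF-least (f ∘ suc) (f≤b ∘ suc))

maxF-attained : ∀ {m} (f : Fin m → ℕ) → Fin m → ∃[ i ] f i ≡ maxF f
maxF-attained {suc m} f _ = attained f
  where
    attained : ∀ {m} (f : Fin (suc m) → ℕ) → ∃[ i ] f i ≡ maxF f
    attained {zero} f = zero , sym (ℕP.⊔-identityʳ (f zero))
    attained {suc m} f with ℕP.⊔-sel (f zero) (maxF (f ∘ suc))
    ... | inj₁ max≡f₀ = zero , sym max≡f₀
    ... | inj₂ max≡rest = let (i , fi≡) = attained (f ∘ suc) in suc i , trans fi≡ (sym max≡rest)

radius-zero-collapses : ∀ {E : Set} {cn : Sub E → ℤ} {k} →
                        HasDecomp cn k 0 → ∀ (a b : E) → a ≡ b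
radius-zero-collapses (D , _ , c , reach) a b =
  Decomposition.σ-inj D a b (trans (sym (at-centre (reach _))) (at-centre (reach _)))
  where
    at-centre : ∀ {u} → ∃[ l ] (l ≤ₙ 0 × Walk (Decomposition.adj D) AllV c u l) → c ≡ u
    at-centre (_ , z≤n , here _) = refl

HasDecomp-widen : ∀ {E : Set} {cn : Sub E → ℤ} {k k′ r} →
                  k ≤ₙ k′ → HasDecomp cn k r → HasDecomp cn k′ r
HasDecomp-widen k≤k′ (D , width , radius) =
  D , (λ v v-internal X X-union → ℤP.≤-trans (width v v-internal X X-union) (+≤+ k≤k′)) , radius

branchDepth-minimal : ∀ {E : Set} {cn : Sub E → ℤ} {d j} →
                      BranchDepth cn d → HasDecomp cn j j → d ≤ₙ j
branchDepth-minimal (inj₁ (_ , refl)) _ = z≤n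
branchDepth-minimal {d = d} {j} (inj₂ (_ , _ , minimal)) decomp with d ℕP.≤? j
... | yes d≤j = d≤j
... | no d≰j = ⊥-elim (minimal j (ℕP.≰⇒> d≰j) decomp)

branchDepth-zero-subsingleton : ∀ {E : Set} {cn : Sub E → ℤ} →
                                BranchDepth cn 0 → ∀ (a b : E) → a ≡ b
branchDepth-zero-subsingleton (inj₁ (all-equal , _)) = all-equal
branchDepth-zero-subsingleton (inj₂ (_ , decomp , _)) = radius-zero-collapses decomp

point-tree : Tree 1
point-tree = record
  { adj = λ _ _ → ⊥
  ; adj-sym = λ _ _ ()
  ; adj-irr = λ _ ()
  ; connected = λ { zero zero → 0 , here tt }
  ; acyclic = λ _ _ _ steps _ → steps zero
  }

module BlockTrees {n m : ℕ} {conn : Sub (Fin n) → ℤ} (isConn : IsConnectivity conn)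
                  (part : Fin n → Fin m) where
  open IsConnectivity isConn
  open Blocks part
  open Gluing part

  Block-any? : ∀ i {P : Block part i → Set} → (∀ a → Dec (P a)) → Dec (∃ P)
  Block-any? i {P} P? =
    Dec.map′ (λ (e , p , x) → (e , p) , x) (λ ((e , p) , x) → e , p , x) (FinP.any? in-block?)
    where
      in-block? : ∀ e → Dec (Σ (part e ≡ i) λ p → P (e , p))
      in-block? e with part e ≟ᶠ i
      ... | no e∉i = no (e∉i ∘ proj₁)
      ... | yes e∈i =
            Dec.map′ (e∈i ,_) (λ (p , x) → subst (λ q → P (e , q)) (≡-irrelevant p e∈i) x)
                     (P? (e , e∈i))

  block-tree : ∀ i {k} → BranchDepth (restrict conn part i) k →
               Σ (BlockTree i k) λ B → Proper conn k B ⊎ (Point B × k ≡ 0)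
  block-tree i (inj₁ (all-equal , refl)) =
    record { size = 1 ; tree = point-tree ; centre = zero ; σ = λ _ _ → zero
           ; σ-inj = λ e f p q _ →
               cong proj₁ (all-equal (e , recompute (part e ≟ᶠ i) p) (f , recompute (part f ≟ᶠ i) q))
           ; reach = λ { zero → 0 , z≤n , here tt } }
    , inj₂ (record { no-edge = λ _ _ () ; single = λ { zero → refl } } , refl)
  block-tree i {k} (inj₂ ((a , b , a≢b) , (D , D-width , c , c-reach) , _)) =
    record { size = size ; tree = tree ; centre = centre ; σ = σᵇ
           ; σ-inj = λ e f p q σe≡σf → cong proj₁ (σ-inj _ _ σe≡σf)
           ; reach = centre-reach }
    , inj₁ (record
        { centre-internal = centre-internal
        ; centre-nb = centre-nb
        ; σ-leaf = λ e p → σ-leaf _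
        ; σ-onto = λ v v-leaf →
            let ((e , p) , σe≡v) = σ-onto v v-leaf in e , p , trans (σᵇ-≡ e p) σe≡v
        ; width = λ v v-internal X X-closed →
            subst (_≤ᶻ + k) (sym (ext _ _ (∩-block-≗-extendSub X i)))
              (D-width v v-internal (X ∘ proj₁) λ { (e , p) (f , q) same → X-closed e f p q
                 (subst₂ (SameCompWithout v) (sym (σᵇ-≡ e p)) (sym (σᵇ-≡ f q)) same) })
        })
    where
      open Decomposition D
      σᵇ : ∀ e → .(part e ≡ i) → Fin size
      σᵇ e p = σ (e , recompute (part e ≟ᶠ i) p)
      σᵇ-≡ : ∀ e p → σᵇ e p ≡ σ (e , p)
      σᵇ-≡ e p = cong (λ q → σ (e , q)) (≡-irrelevant _ _)
      k≢0 : k ≢ 0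
      k≢0 refl = a≢b (radius-zero-collapses (D , D-width , c , c-reach) a b)
      recentred =
        Recentre.internal-centre D a (ℕP.n≢0⇒n>0 k≢0) c (Block-any? i (λ x → σ x ≟ᶠ c)) c-reach
      centre = proj₁ recentred
      centre-internal = proj₁ (proj₂ recentred)
      centre-nb = proj₁ (proj₂ (proj₂ recentred))
      centre-reach = proj₂ (proj₂ (proj₂ recentred))

module Restriction {n m : ℕ} {conn : Sub (Fin n) → ℤ} (isConn : IsConnectivity conn)
                   (part : Fin n → Fin m) (blocks-separate : ∀ l → conn (blockSet part l) ≡ + 0)
                   (i : Fin m) where
  open IsConnectivity isConn
  open Connectivity isConn
  open Pruning (restrict conn part i)

  Block-≡ : ∀ (x y : Block part i) → proj₁ x ≡ proj₁ y → x ≡ y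
  Block-≡ (e , p) (.e , q) refl = cong (e ,_) (≡-irrelevant p q)

  module _ {d r : ℕ} (D : Decomposition (Fin n)) (D-width : WidthAtMost conn D d)
           (c : Fin (Decomposition.size D)) (c-reach : Reaches (Decomposition.tree D) c r)
           (a b : Block part i) (a≢b : a ≢ b) where
    open Decomposition D

    -- Extend Y to the union X of the parts meeting it. Membership in X is undecidable, but the
    -- bound is decidable, so X may be formed classically.
    restricted-width : ∀ v → Internal v → ∀ Y →
                       (∀ x y → SameCompWithout v (σ (proj₁ x)) (σ (proj₁ y)) →
                                Y x ≡ true → Y y ≡ true) →
                       restrict conn part i Y ≤ᶻ + d
    restricted-width v v-internal Y Y-closed =
      decidable-stable (restrict conn part i Y ℤP.≤? + d) λ fails →
        ¬¬-decidable n Meets λ meets? → fails (bound meets?)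
      where
        Meets : Fin n → Set
        Meets e = Σ (Block part i) λ x → Y x ≡ true × SameCompWithout v (σ (proj₁ x)) (σ e)
        bound : (∀ e → Dec (Meets e)) → restrict conn part i Y ≤ᶻ + d
        bound meets? = subst (_≤ᶻ + d) (sym (ext _ _ Y≗X∩Bi))
                         (ℤP.≤-trans (conn-∩-separation X (blockSet part i) (blocks-separate i))
                                     (D-width v v-internal X X-union))
          where
            X : Sub (Fin n)
            X e = does (meets? e)
            X-union : UnionOfParts v X
            X-union e f (_ , e⇝f) Xe with meets? e | meets? f
            ... | yes (x , Yx , _ , x⇝e) | no none = ⊥-elim (none (x , Yx , _ , walk-++ x⇝e e⇝f))
            ... | yes _ | yes _ = refl
            Y≗X∩Bi : extendSub part i Y ≗ X ∩ blockSet part i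
            Y≗X∩Bi e with part e ≟ᶠ i
            ... | no _ = sym (BoolP.∧-zeroʳ (X e))
            ... | yes p with Y (e , p) in Ye | meets? e
            ...   | true | yes _ = refl
            ...   | true | no none =
                    ⊥-elim (none ((e , p) , Ye , 0 ,
                                  here (v-internal ∘ λ σe≡v → subst Leaf σe≡v (σ-leaf e))))
            ...   | false | yes (x , Yx , x⇝e) with () ← trans (sym (Y-closed x (e , p) x⇝e Yx)) Ye
            ...   | false | no _ = refl

    restricted : Predecomposition d r size
    restricted = record
      { tree = tree ; σ = σ ∘ proj₁
      ; σ-inj = λ x y σx≡σy → Block-≡ x y (σ-inj _ _ σx≡σy)
      ; σ-leaf = σ-leaf ∘ proj₁
      ; a₁ = a ; a₂ = b ; a₁≢a₂ = a≢b
      ; σ-nonadjacent = λ x y x~y → let (v , v-internal) = hasInternal in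
          [ (λ v≡x → v-internal (subst Leaf (sym v≡x) (σ-leaf (proj₁ x))))
          , (λ v≡y → v-internal (subst Leaf (sym v≡y) (σ-leaf (proj₁ y)))) ]′
          (TreeProperties.adjacent-leaves-span tree (σ-leaf (proj₁ x)) (σ-leaf (proj₁ y)) x~y v)
      ; width = restricted-width
      ; centre = c ; reach = c-reach
      }

  depth-≤ : ∀ {k d} → BranchDepth (restrict conn part i) k → BranchDepth conn d → k ≤ₙ d
  depth-≤ (inj₁ (_ , refl)) _ = z≤n
  depth-≤ {k} {d} (inj₂ ((a , b , a≢b) , _ , minimal)) d-depth with k ℕP.≤? d | d-depth
  ... | yes k≤d | _ = k≤d
  ... | no _ | inj₁ (all-equal , _) = ⊥-elim (a≢b (Block-≡ a b (all-equal _ _)))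
  ... | no k≰d | inj₂ (_ , (D , D-width , c , c-reach) , _) =
        ⊥-elim (prune d d (restricted D D-width c c-reach a b a≢b) (minimal d (ℕP.≰⇒> k≰d)))

module Shift {n m : ℕ} (part : Fin n → Fin m) where

  part⁺ : Fin n → Fin (suc m)
  part⁺ = suc ∘ part

  private
    module G = Gluing part
    module G⁺ = Gluing part⁺

  blockSet-suc : ∀ i → blockSet part⁺ (suc i) ≗ blockSet part i
  blockSet-suc i e = by-cases (part e ≟ᶠ i)
    where
      by-cases : Dec (part e ≡ i) → blockSet part⁺ (suc i) e ≡ blockSet part i e
      by-cases (yes e∈i) =
        trans (Blocks.blockSet-∈ part⁺ (cong suc e∈i)) (sym (Blocks.blockSet-∈ part e∈i))
      by-cases (no e∉i) =
        trans (Blocks.blockSet-∉ part⁺ (e∉i ∘ FinP.suc-injective)) (sym (Blocks.blockSet-∉ part e∉i))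

  shift-block : ∀ {i d} → G.BlockTree i d → G⁺.BlockTree (suc i) d
  shift-block B = record
    { size = size ; tree = tree ; centre = centre
    ; σ = λ e p → σ e (FinP.suc-injective p)
    ; σ-inj = λ e f p q → σ-inj e f (FinP.suc-injective p) (FinP.suc-injective q)
    ; reach = reach }
    where open G.BlockTree B

  shift-proper : ∀ {conn w i d} {B : G.BlockTree i d} → IsConnectivity conn →
                 G.Proper conn w B → G⁺.Proper conn w (shift-block B)
  shift-proper {conn} {w} {i} isConn P = record
    { centre-internal = centre-internal ; centre-nb = centre-nb
    ; σ-leaf = λ e p → σ-leaf e (FinP.suc-injective p)
    ; σ-onto = λ v v-leaf → let (e , p , σe≡v) = σ-onto v v-leaf in e , cong suc p , σe≡v
    ; width = λ v v-internal X X-closed →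
        subst (_≤ᶻ + w) (IsConnectivity.ext isConn _ _ (cong (X _ ∧_) ∘ sym ∘ blockSet-suc i))
          (width v v-internal X λ e f p q → X-closed e f (cong suc p) (cong suc q)) }
    where open G.Proper P

  shift-point : ∀ {i d} {B : G.BlockTree i d} → G.Point B → G⁺.Point (shift-block B)
  shift-point P = record { no-edge = G.Point.no-edge P ; single = G.Point.single P }

module Assembly {n m : ℕ} {conn : Sub (Fin n) → ℤ} (isConn : IsConnectivity conn)
                (part : Fin n → Fin m) (part-onto : ∀ i → ∃[ e ] part e ≡ i)
                (blocks-separate : ∀ i → conn (blockSet part i) ≡ + 0)
                (ks : Fin m → ℕ) (ks-depth : ∀ i → BranchDepth (restrict conn part i) (ks i)) where
  open Gluing part
  open BlockTrees isConn part

  k : ℕ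
  k = maxF ks

  block : ∀ i → BlockTree i (ks i)
  block i = proj₁ (block-tree i (ks-depth i))

  kind : ∀ i → Proper conn k (block i) ⊎ Point (block i)
  kind i = Data.Sum.map (Proper-widen (maxF-upper ks i)) proj₁ (proj₂ (block-tree i (ks-depth i)))

  point-depth-zero : ∀ i → Point (block i) → ks i ≡ 0
  point-depth-zero i P with proj₂ (block-tree i (ks-depth i))
  ... | inj₁ P′ = ⊥-elim (Point.no-edge P _ _ (proj₂ (Proper.centre-nb P′)))
  ... | inj₂ (_ , ks≡0) = ks≡0

  unique-maximum : ∀ i₀ → ks i₀ ≡ k → k ≢ 0 → (∀ j → j ≢ i₀ → ks j <ₙ k) →
                   HasDecomp conn k k
  unique-maximum i₀ ks-i₀ k≢0 below =
    Glue.glued-decomposition isConn blocks-separate k i₀ ks block kind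
      (λ j _ _ → part-onto j) hub-not-point k (ℕP.≤-reflexive ks-i₀) below
    where
      hub-not-point : ∀ j → Point (block j) → j ≡ i₀ → _
      hub-not-point j P refl = ⊥-elim (k≢0 (trans (sym ks-i₀) (point-depth-zero j P)))

  -- A new empty block zero serves as the hub, so that every block tree becomes a spoke.
  two-maxima : ∀ i₁ i₂ → i₁ ≢ i₂ → HasDecomp conn k (suc k)
  two-maxima i₁ i₂ i₁≢i₂ =
    Gluing.Glue.glued-decomposition part⁺ isConn separate⁺ k zero depth⁺ block⁺ kind⁺
      inhabited⁺ hub⁺ (suc k) z≤n spoke-depth⁺
    where
      open Shift part
      module G⁺ = Gluing part⁺
      depth⁺ : Fin (suc m) → ℕ
      depth⁺ zero = 0
      depth⁺ (suc i) = ks i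
      block⁺ : ∀ j → G⁺.BlockTree j (depth⁺ j)
      block⁺ zero = record { size = 1 ; tree = point-tree ; centre = zero ; σ = λ _ ()
                           ; σ-inj = λ _ _ () ; reach = λ { zero → 0 , z≤n , here tt } }
      block⁺ (suc i) = shift-block (block i)
      kind⁺ : ∀ j → G⁺.Proper conn k (block⁺ j) ⊎ G⁺.Point (block⁺ j)
      kind⁺ zero = inj₂ (record { no-edge = λ _ _ () ; single = λ { zero → refl } })
      kind⁺ (suc i) = Data.Sum.map (shift-proper isConn) shift-point (kind i)
      inhabited⁺ : ∀ j → G⁺.Point (block⁺ j) → j ≢ zero → ∃[ e ] part⁺ e ≡ j
      inhabited⁺ zero _ j≢0 = ⊥-elim (j≢0 refl)
      inhabited⁺ (suc i) _ _ = let (e , e∈i) = part-onto i in e , cong suc e∈i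
      hub⁺ : ∀ j → G⁺.Point (block⁺ j) → j ≡ zero →
             (∀ e → part⁺ e ≢ j) × ∃[ j₁ ] ∃[ j₂ ] j₁ ≢ j₂ × j₁ ≢ zero × j₂ ≢ zero
      hub⁺ zero _ _ = (λ _ ()) , suc i₁ , suc i₂ , i₁≢i₂ ∘ FinP.suc-injective , (λ ()) , (λ ())
      separate⁺ : ∀ j → conn (blockSet part⁺ j) ≡ + 0
      separate⁺ zero =
        Connectivity.conn-empty isConn _ λ e → Blocks.blockSet-∉ part⁺ {e} {zero} λ ()
      separate⁺ (suc i) = trans (IsConnectivity.ext isConn _ _ (blockSet-suc i)) (blocks-separate i)
      spoke-depth⁺ : ∀ j → j ≢ zero → suc (depth⁺ j) ≤ₙ suc k
      spoke-depth⁺ zero j≢0 = ⊥-elim (j≢0 refl)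
      spoke-depth⁺ (suc i) _ = s≤s (maxF-upper ks i)

  MaximalPair : Set
  MaximalPair = ∃[ i ] ∃[ j ] (i < j × ks i ≡ k × ks j ≡ k)

  maximalPair? : Dec MaximalPair
  maximalPair? =
    FinP.any? λ i → FinP.any? λ j → (i FinP.<? j) ×-dec (ks i ℕP.≟ k) ×-dec (ks j ℕP.≟ k)

  maximalPair : ∀ i j → i ≢ j → ks i ≡ k → ks j ≡ k → MaximalPair
  maximalPair i j i≢j ks-i ks-j with FinP.<-cmp i j
  ... | tri< i<j _ _ = i , j , i<j , ks-i , ks-j
  ... | tri≈ _ i≡j _ = ⊥-elim (i≢j i≡j)
  ... | tri> _ _ j<i = j , i , j<i , ks-j , ks-i

  k≤depth : ∀ {d} → BranchDepth conn d → k ≤ₙ d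
  k≤depth d-depth =
    maxF-least ks λ i → Restriction.depth-≤ isConn part blocks-separate i (ks-depth i) d-depth

  depth≤k : ∀ {d} → ¬ MaximalPair → BranchDepth conn d → d ≤ₙ k
  depth≤k _ (inj₁ (_ , refl)) = z≤n
  depth≤k no-pair d-depth@(inj₂ ((a , b , a≢b) , _)) with k ℕP.≟ 0
  ... | no k≢0 = branchDepth-minimal d-depth (unique-maximum i₀ ks-i₀ k≢0 below)
    where
      i₀ = proj₁ (maxF-attained ks (part a))
      ks-i₀ = proj₂ (maxF-attained ks (part a))
      below : ∀ j → j ≢ i₀ → ks j <ₙ k
      below j j≢i₀ =
        ℕP.≤∧≢⇒< (maxF-upper ks j) λ ks-j → no-pair (maximalPair j i₀ j≢i₀ ks-j ks-i₀)
  ... | yes k≡0 with part a ≟ᶠ part b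
  ...   | no a∉b =
          ⊥-elim (no-pair (maximalPair (part a) (part b) a∉b (all-k (part a)) (all-k (part b))))
    where
      all-k : ∀ i → ks i ≡ k
      all-k i = ℕP.≤-antisym (maxF-upper ks i) (subst (_≤ₙ ks i) (sym k≡0) z≤n)
  ...   | yes a∈b =
          ⊥-elim (a≢b (cong proj₁ (branchDepth-zero-subsingleton zero-depth (a , refl) (b , sym a∈b))))
    where
      zero-depth : BranchDepth (restrict conn part (part a)) 0
      zero-depth = subst (BranchDepth _)
                         (ℕP.n≤0⇒n≡0 (subst (ks (part a) ≤ₙ_) k≡0 (maxF-upper ks (part a))))
                         (ks-depth (part a))

lemma2p3 : (n : ℕ) (conn : Sub (Fin n) → ℤ) → IsConnectivity conn →
           (m : ℕ) (part : Fin n → Fin m) →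
           (∀ i → ∃[ e ] part e ≡ i) →
           (∀ i → conn (blockSet part i) ≡ + 0) →
           (ks : Fin m → ℕ) → (∀ i → BranchDepth (restrict conn part i) (ks i)) →
           (d : ℕ) → BranchDepth conn d →
           (d ≡ maxF ks ⊎ d ≡ suc (maxF ks))
           × (d ≡ suc (maxF ks) →
                ∃[ i ] ∃[ j ] (i < j × ks i ≡ maxF ks × ks j ≡ maxF ks)
                × HasDecomp conn (maxF ks) (suc (maxF ks)))
lemma2p3 n conn isConn m part part-onto blocks-separate ks ks-depth d d-depth = case maximalPair? of λ where
    (yes (i , j , i<j , ks-i , ks-j)) →
      let star = two-maxima i j (FinP.<⇒≢ i<j)
      in m≤n≤1+m⇒n≡m⊎n≡1+m (k≤depth d-depth)
                             (branchDepth-minimal d-depth (HasDecomp-widen (ℕP.n≤1+n k) star)) ,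
         λ _ → i , j , (i<j , ks-i , ks-j) , star
    (no no-pair) →
      let d≡k = ℕP.≤-antisym (depth≤k no-pair d-depth) (k≤depth d-depth)
      in inj₁ d≡k , λ d≡1+k → ⊥-elim (ℕP.1+n≢n (trans (sym d≡1+k) d≡k))
  where open Assembly isConn part part-onto blocks-separate ks ks-depth
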